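{- Let $P$ be a finite poset with $n\geq 2$ elements, let $f$ be a linear extension of $P$, and let $a$ be a minimal element of $P$. Then $\pi_{a,a\oplus_f 1}$ is an order-preserving partition of $P$.
   Context: A linear extension of $P$ is an order-preserving bijection $f\colon P\to\{0,\dots,n-1\}$; $x\oplus_f k=f^{ -1}(f(x)\oplus k)$ with $\oplus$ addition modulo $n$. For distinct $a,b\in P$, $\pi_{a,b}=\{\{a,b\}\}\cup\{\{x\}:x\in P\setminus\{a,b\}\}$. For an equivalence relation $\rho$ on $P$, a $\rho$-circle is a sequence $x_0,\dots,x_m$ with $x_0=x_m$ such that for each $i$ either $(x_{i-1},x_i)\in\rho$ or $x_{i-1}<x_i$; $\rho$ is an order-congruence if every $\rho$-circle stays within a single $\rho$-class, and a partition is order-preserving if it is the class partition of an order-congruence. -}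

module Defs where

import Data.Nat
open Data.Nat using (ℕ; zero; suc; _+_; _%_)
open import Data.Nat.DivMod using (m%n<n)
import Data.Fin as F
open F using (Fin; toℕ; fromℕ<)
open import Data.Product using (_×_; _,_)
open import Data.Sum using (_⊎_)
open import Relation.Nullary using (¬_)
open import Relation.Binary.PropositionalEquality using (_≡_; _≢_)
open import Relation.Binary.Structures using (IsPartialOrder; IsEquivalence)
open import Function.Bundles using (_↔_; Inverse)

Strict : {P : Set} → (P → P → Set) → P → P → Set
Strict _≤_ x y = (x ≤ y) × (x ≢ y)

Minimal : {P : Set} → (P → P → Set) → P → Set
Minimal _≤_ a = ∀ x → ¬ Strict _≤_ x a

IsLinearExtension : {P : Set} (_≤_ : P → P → Set) {n : ℕ} → P ↔ Fin n → Set
IsLinearExtension {P} _≤_ f = ∀ (x y : P) → x ≤ y → Inverse.to f x F.≤ Inverse.to f y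

addMod : {n : ℕ} → Fin n → ℕ → Fin n
addMod {suc n} i k = fromℕ< (m%n<n (toℕ i + k) (suc n))

shiftBy : {P : Set} {n : ℕ} → P ↔ Fin n → P → ℕ → P
shiftBy f x k = Inverse.from f (addMod (Inverse.to f x) k)

-- The equivalence relation whose class partition is π_{a,b}:
-- {a,b} is one class, all other classes are singletons.
πRel : {P : Set} → P → P → P → P → Set
πRel a b x y = (x ≡ y) ⊎ ((x ≡ a × y ≡ b) ⊎ (x ≡ b × y ≡ a))

-- A ρ-circle: x₀,…,x_m (given as c : ℕ → P, only indices ≤ m matter)
-- with x₀ = x_m and each step either ρ-related or strictly increasing.
IsCircle : {P : Set} (_≤_ : P → P → Set) (ρ : P → P → Set) (m : ℕ) (c : ℕ → P) → Set
IsCircle _≤_ ρ m c =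
  (c 0 ≡ c m) × (∀ i → suc i Data.Nat.≤ m → ρ (c i) (c (suc i)) ⊎ Strict _≤_ (c i) (c (suc i)))

IsOrderCongruence : {P : Set} (_≤_ : P → P → Set) (ρ : P → P → Set) → Set
IsOrderCongruence {P} _≤_ ρ =
  IsEquivalence ρ ×
  (∀ (m : ℕ) (c : ℕ → P) → IsCircle _≤_ ρ m c → ∀ i j → i Data.Nat.≤ m → j Data.Nat.≤ m → ρ (c i) (c j))

-- A partition given by its equivalence relation ρ is order-preserving
-- iff ρ (its class relation) is an order-congruence.
OrderPreservingPartition : {P : Set} (_≤_ : P → P → Set) (ρ : P → P → Set) → Set
OrderPreservingPartition = IsOrderCongruence

module Submission where

-- Let r(x) = f(x) ∈ ℕ be the rank of x in the linear extension
-- and b = a ⊕_f 1.  Collapse a onto b (κ a = b, κ x = x otherwise); then the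
-- kernel of g = r ∘ κ is exactly π_{a,b}, because r is injective.  The map
-- g is weakly increasing along every step of a π_{a,b}-circle: π-steps keep g
-- fixed, and a strict step x < y has y ≠ a (a is minimal), so g y = r y, while
-- g x ≤ r y since r(b) ≤ r(a) + 1 and r is strictly monotone.  A weakly
-- increasing sequence of naturals that returns to its start is constant, so g
-- is constant on a circle, i.e. the circle stays in one π_{a,b}-class.

open import Defs
open import Data.Nat using (ℕ; zero; suc; _+_; _≤_; _<_; s≤s; z≤n)
open import Data.Nat.Properties
  using (≤-refl; ≤-trans; ≤-antisym; ≤-reflexive; <⇒≤; +-comm; m≤n⇒m<n∨m≡n)
open import Data.Nat.DivMod using (m%n≤m)
open import Data.Fin using (Fin; toℕ)
open import Data.Fin.Properties using (toℕ-fromℕ<; toℕ-injective; inj⇒≟)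
open import Data.Product using (_,_)
open import Data.Sum using (inj₁; inj₂)
open import Relation.Nullary using (yes; no; contradiction)
open import Relation.Binary.Definitions using (DecidableEquality)
open import Relation.Binary.PropositionalEquality
open import Relation.Binary.Structures using (IsPartialOrder; IsEquivalence)
open import Function.Base using (_∘_)
open import Function.Bundles using (_↔_; Inverse; Injection)
open import Function.Properties.Inverse using (↔⇒↣)

module MonotoneSequence (h : ℕ → ℕ) (m : ℕ)
    (step : ∀ i → suc i ≤ m → h i ≤ h (suc i)) where

  increasing : ∀ {i j} → i ≤ j → j ≤ m → h i ≤ h j
  increasing {j = zero}  z≤n  _    = ≤-refl
  increasing {j = suc j} i≤j′ j′≤m with m≤n⇒m<n∨m≡n i≤j′
  ... | inj₁ (s≤s i≤j) = ≤-trans (increasing i≤j (<⇒≤ j′≤m)) (step j j′≤m)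
  ... | inj₂ refl      = ≤-refl

  closed⇒constant : h 0 ≡ h m → ∀ i → i ≤ m → h i ≡ h 0
  closed⇒constant closed i i≤m =
    ≤-antisym (subst (h i ≤_) (sym closed) (increasing i≤m ≤-refl))
              (increasing z≤n i≤m)

-- (2) Let ρ be the kernel of g : P → ℕ.  If g weakly increases along strict
-- steps of the order, then ρ is an order-congruence: g weakly increases along
-- every step of a ρ-circle, hence is constant on it.
kernel-orderCongruence :
  {P : Set} (_≼_ : P → P → Set) (ρ : P → P → Set) (g : P → ℕ) →
  (∀ {x y} → ρ x y → g x ≡ g y) → (∀ {x y} → g x ≡ g y → ρ x y) →
  (∀ {x y} → Strict _≼_ x y → g x ≤ g y) →
  IsOrderCongruence _≼_ ρ
kernel-orderCongruence _≼_ ρ g ρ⇒≡ ≡⇒ρ strict-mono = kernel-isEquivalence , circles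
  where
  kernel-isEquivalence : IsEquivalence ρ
  kernel-isEquivalence = record
    { refl  = ≡⇒ρ refl
    ; sym   = λ xy → ≡⇒ρ (sym (ρ⇒≡ xy))
    ; trans = λ xy yz → ≡⇒ρ (trans (ρ⇒≡ xy) (ρ⇒≡ yz))
    }

  circles : ∀ m c → IsCircle _≼_ ρ m c → ∀ i j → i ≤ m → j ≤ m → ρ (c i) (c j)
  circles m c (closed , steps) i j i≤m j≤m =
    ≡⇒ρ (trans (constant i i≤m) (sym (constant j j≤m)))
    where
    step : ∀ i → suc i ≤ m → g (c i) ≤ g (c (suc i))
    step i si≤m with steps i si≤m
    ... | inj₁ related = ≤-reflexive (ρ⇒≡ related)
    ... | inj₂ strict  = strict-mono strict

    open MonotoneSequence (λ k → g (c k)) m step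
    constant : ∀ i → i ≤ m → g (c i) ≡ g (c 0)
    constant = closed⇒constant (cong g closed)

module Collapse {P : Set} (_≟_ : DecidableEquality P) (a b : P) where

  collapse : P → P
  collapse x with x ≟ a
  ... | yes _ = b
  ... | no  _ = x

  collapse-a≡collapse-b : collapse a ≡ collapse b
  collapse-a≡collapse-b with a ≟ a | b ≟ a
  ... | no a≢a | _     = contradiction refl a≢a
  ... | yes _  | yes _ = refl
  ... | yes _  | no  _ = refl

  πRel⇒collapse≡ : ∀ {x y} → πRel a b x y → collapse x ≡ collapse y
  πRel⇒collapse≡ (inj₁ refl)                 = refl
  πRel⇒collapse≡ (inj₂ (inj₁ (refl , refl))) = collapse-a≡collapse-b
  πRel⇒collapse≡ (inj₂ (inj₂ (refl , refl))) = sym collapse-a≡collapse-b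

  collapse≡⇒πRel : ∀ x y → collapse x ≡ collapse y → πRel a b x y
  collapse≡⇒πRel x y e with x ≟ a | y ≟ a
  ... | yes x≡a | yes y≡a = inj₁ (trans x≡a (sym y≡a))
  ... | yes x≡a | no  _   = inj₂ (inj₁ (x≡a , sym e))
  ... | no  _   | yes y≡a = inj₂ (inj₂ (e , y≡a))
  ... | no  _   | no  _   = inj₁ e

  -- If r is strictly monotone, a is minimal and r b ≤ r a + 1, then r ∘ collapse
  -- weakly increases along strict steps: the top y of a step is never a.
  collapse-monotone :
    (_≼_ : P → P → Set) (r : P → ℕ) →
    (∀ {x y} → Strict _≼_ x y → r x < r y) → Minimal _≼_ a → r b ≤ suc (r a) →
    ∀ {x y} → Strict _≼_ x y → r (collapse x) ≤ r (collapse y)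
  collapse-monotone _≼_ r r-strict minimal rb≤ra+1 {x} {y} x<y with y ≟ a
  ... | yes refl = contradiction x<y (minimal x)
  ... | no  _ with x ≟ a
  ...   | no  _    = <⇒≤ (r-strict x<y)
  ...   | yes refl = ≤-trans rb≤ra+1 (r-strict x<y)

addMod-≤ : ∀ {n} (i : Fin n) (k : ℕ) → toℕ (addMod i k) ≤ toℕ i + k
addMod-≤ {suc n} i k =
  subst (_≤ toℕ i + k) (sym (toℕ-fromℕ< _)) (m%n≤m (toℕ i + k) (suc n))

module Rank {P : Set} (_≼_ : P → P → Set) {n : ℕ} (f : P ↔ Fin n)
    (linear : IsLinearExtension _≼_ f) where

  rank : P → ℕ
  rank x = toℕ (Inverse.to f x)

  rank-injective : ∀ {x y} → rank x ≡ rank y → x ≡ y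
  rank-injective e = Injection.injective (↔⇒↣ f) (toℕ-injective e)

  rank-strict : ∀ {x y} → Strict _≼_ x y → rank x < rank y
  rank-strict {x} {y} (x≼y , x≢y) with m≤n⇒m<n∨m≡n (linear x y x≼y)
  ... | inj₁ x<y = x<y
  ... | inj₂ e   = contradiction (rank-injective e) x≢y

  rank-successor : ∀ x → rank (shiftBy f x 1) ≤ suc (rank x)
  rank-successor x =
    subst₂ _≤_ (cong toℕ (sym (Inverse.strictlyInverseˡ f _))) (+-comm (rank x) 1)
           (addMod-≤ (Inverse.to f x) 1)

lemma22 : (P : Set) (_≼_ : P → P → Set) → IsPartialOrder _≡_ _≼_ →
          (n : ℕ) → 2 ≤ n → (f : P ↔ Fin n) → IsLinearExtension _≼_ f →
          (a : P) → Minimal _≼_ a →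
          OrderPreservingPartition _≼_ (πRel a (shiftBy f a 1))
lemma22 P _≼_ _ n _ f linear a minimal =
  kernel-orderCongruence _≼_ (πRel a b) (rank ∘ collapse)
    (λ xy → cong rank (πRel⇒collapse≡ xy))
    (λ {x} {y} e → collapse≡⇒πRel x y (rank-injective e))
    (collapse-monotone _≼_ rank rank-strict minimal (rank-successor a))
  where
  b : P
  b = shiftBy f a 1
  open Rank _≼_ f linear
  open Collapse (inj⇒≟ (↔⇒↣ f)) a b
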